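{- For every context $\Gamma$ and type $T$: if $\Gamma\vdash\mathbf{0}:T$ then $T\equiv\overline{0}$.
   Context: Lineal terms over a commutative ring $(\mathcal{S},+,\times)$: basis terms $\mathbf{b}::=x\mid\lambda x\,\mathbf{t}$, terms $\mathbf{t}::=\mathbf{b}\mid(\mathbf{t})~\mathbf{r}\mid\mathbf{0}\mid\alpha.\mathbf{t}\mid\mathbf{t}+\mathbf{r}$, modulo AC of $+$. Scalar type system: types $T::=U\mid\forall X.T\mid\alpha.T\mid\overline{0}$, unit types $U::=X\mid U\to T\mid\forall X.U$, substitution of type variables only by unit types; $\equiv$ is the least congruence with $\alpha.\overline{0}\equiv\overline{0}$, $0.T\equiv\overline{0}$, $1.T\equiv T$, $\alpha.(\beta.T)\equiv(\alpha\times\beta).T$, $\forall X.\alpha.T\equiv\alpha.\forall X.T$. Contexts: finite sets of $x:U$ ($U$ unit). Rules: $\Gamma,x:U\vdash x:U$; from $\Gamma\vdash\mathbf{t}:T$, $T\equiv S$ infer $\Gamma\vdash\mathbf{t}:S$; from $\Gamma\vdash\mathbf{t}:\alpha.(U\to T)$, $\Gamma\vdash\mathbf{r}:\beta.U$ infer $\Gamma\vdash(\mathbf{t})~\mathbf{r}:(\alpha\times\beta).T$; from $\Gamma,x:U\vdash\mathbf{t}:T$ infer $\Gamma\vdash\lambda x\,\mathbf{t}:U\to T$; from $\Gamma\vdash\mathbf{t}:\forall X.T$ infer $\Gamma\vdash\mathbf{t}:T[U/X]$ ($U$ unit); from $\Gamma\vdash\mathbf{t}:T$ infer $\Gamma\vdash\mathbf{t}:\forall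 X.T$ if $X$ not free in $\Gamma$; $\Gamma\vdash\mathbf{0}:\overline{0}$; from $\Gamma\vdash\mathbf{t}:\alpha.T$, $\Gamma\vdash\mathbf{r}:\beta.T$ infer $\Gamma\vdash\mathbf{t}+\mathbf{r}:(\alpha+\beta).T$; from $\Gamma\vdash\mathbf{t}:T$ infer $\Gamma\vdash\alpha.\mathbf{t}:\alpha.T$. -}

module Defs where

open import Level using (_⊔_)
open import Data.Nat using (ℕ; zero; suc; pred; _<ᵇ_; _≡ᵇ_)
open import Data.Bool using (if_then_else_)
open import Data.Product using (_×_; _,_; proj₁)
open import Data.List using (List; _∷_; map)
open import Data.List.Membership.Propositional using (_∈_)
open import Relation.Nullary using (¬_)
open import Algebra.Bundles using (CommutativeRing)

module Lineal {c ℓ} (S : CommutativeRing c ℓ) where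
  open CommutativeRing S renaming (Carrier to Sc; _+_ to _+ˢ_; _*_ to _*ˢ_; 0# to 0ˢ; 1# to 1ˢ)

  -- Terms (term variables are named by natural numbers).
  -- Raw syntax; the AC-class of 𝟎 is the singleton {𝟎}, so for the
  -- statement at hand raw syntax is enough.
  data Term : Set c where
    var  : ℕ → Term
    lam  : ℕ → Term → Term
    app  : Term → Term → Term
    𝟎    : Term
    _·ₜ_ : Sc → Term → Term
    _+ₜ_ : Term → Term → Term

  -- Types, with type variables as de Bruijn indices.
  --   tvar n  : type variable X
  --   U ⇒ T   : arrow (U must be a unit type)
  --   ∀' T    : ∀X.T (binds index 0)
  --   α · T   : scalar type α.T
  --   𝟘       : the type 0̄
  infixr 20 _⇒_
  infixr 25 _·_
  data Ty : Set c where
    tvar : ℕ → Ty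
    _⇒_  : Ty → Ty → Ty
    ∀'   : Ty → Ty
    _·_  : Sc → Ty → Ty
    𝟘    : Ty

  mutual
    data IsUnit : Ty → Set c where
      u-var : ∀ n → IsUnit (tvar n)
      u-arr : ∀ {U T} → IsUnit U → IsType T → IsUnit (U ⇒ T)
      u-all : ∀ {U} → IsUnit U → IsUnit (∀' U)

    data IsType : Ty → Set c where
      t-unit : ∀ {U} → IsUnit U → IsType U
      t-all  : ∀ {T} → IsType T → IsType (∀' T)
      t-scal : ∀ {T} α → IsType T → IsType (α · T)
      t-zero : IsType 𝟘

  shift : ℕ → Ty → Ty
  shift k (tvar n) = if n <ᵇ k then tvar n else tvar (suc n)
  shift k (A ⇒ B)  = shift k A ⇒ shift k B
  shift k (∀' A)   = ∀' (shift (suc k) A)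
  shift k (α · A)  = α · shift k A
  shift k 𝟘        = 𝟘

  shiftN : ℕ → Ty → Ty
  shiftN zero    A = A
  shiftN (suc m) A = shift 0 (shiftN m A)

  subst : ℕ → Ty → Ty → Ty
  subst k U (tvar n) =
    if n <ᵇ k then tvar n else (if n ≡ᵇ k then shiftN k U else tvar (pred n))
  subst k U (A ⇒ B) = subst k U A ⇒ subst k U B
  subst k U (∀' A)  = ∀' (subst (suc k) U A)
  subst k U (α · A) = α · subst k U A
  subst k U 𝟘       = 𝟘

  _[_] : Ty → Ty → Ty
  T [ U ] = subst 0 U T

  infix 4 _≃_
  data _≃_ : Ty → Ty → Set (c ⊔ ℓ) where
    ≃-refl  : ∀ {T} → IsType T → T ≃ T
    ≃-sym   : ∀ {T R} → T ≃ R → R ≃ T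
    ≃-trans : ∀ {T R Q} → T ≃ R → R ≃ Q → T ≃ Q
    ax-α0   : ∀ α → α · 𝟘 ≃ 𝟘
    ax-0T   : ∀ {T} → IsType T → 0ˢ · T ≃ 𝟘
    ax-1T   : ∀ {T} → IsType T → 1ˢ · T ≃ T
    ax-αβ   : ∀ {T} α β → IsType T → α · (β · T) ≃ (α *ˢ β) · T
    ax-∀α   : ∀ {T} α → IsType T → ∀' (α · T) ≃ α · ∀' T
    c-scal  : ∀ {α β T R} → α ≈ β → T ≃ R → α · T ≃ β · R
    c-all   : ∀ {T R} → T ≃ R → ∀' T ≃ ∀' R
    c-arr   : ∀ {U U' T R} → IsUnit U → IsUnit U' →
              U ≃ U' → T ≃ R → U ⇒ T ≃ U' ⇒ R

  Ctx : Set c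
  Ctx = List (ℕ × Ty)

  dom : Ctx → List ℕ
  dom = map proj₁

  shiftCtx : Ctx → Ctx
  shiftCtx = map (λ { (x , U) → (x , shift 0 U) })

  -- Typing rules.  Rule ∀I ("X not free in Γ") is rendered in de Bruijn
  -- style: the premise is typed in the shifted context.
  infix 3 _⊢_∷_
  data _⊢_∷_ : Ctx → Term → Ty → Set (c ⊔ ℓ) where
    ax   : ∀ {Γ x U} → (x , U) ∈ Γ → Γ ⊢ var x ∷ U
    ≡-r  : ∀ {Γ t T R} → Γ ⊢ t ∷ T → T ≃ R → Γ ⊢ t ∷ R
    →E   : ∀ {Γ t r α β U T} → Γ ⊢ t ∷ α · (U ⇒ T) → Γ ⊢ r ∷ β · U →
           Γ ⊢ app t r ∷ (α *ˢ β) · T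
    →I   : ∀ {Γ x t U T} → IsUnit U → ¬ (x ∈ dom Γ) →
           ((x , U) ∷ Γ) ⊢ t ∷ T → Γ ⊢ lam x t ∷ U ⇒ T
    ∀E   : ∀ {Γ t T U} → IsUnit U → Γ ⊢ t ∷ ∀' T → Γ ⊢ t ∷ T [ U ]
    ∀I   : ∀ {Γ t T} → shiftCtx Γ ⊢ t ∷ T → Γ ⊢ t ∷ ∀' T
    ax0  : ∀ {Γ} → Γ ⊢ 𝟎 ∷ 𝟘
    +I   : ∀ {Γ t r α β T} → Γ ⊢ t ∷ α · T → Γ ⊢ r ∷ β · T →
           Γ ⊢ t +ₜ r ∷ (α +ˢ β) · T
    sI   : ∀ {Γ t T} α → Γ ⊢ t ∷ T → Γ ⊢ α ·ₜ t ∷ α · T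

-- A derivation of Γ ⊢ 𝟎 : T can only use the axiom for 𝟎, the conversion
-- rule and ∀-introduction/elimination.  The predicate Null γ T records, in
-- a purely syntactic way, that γ.T is zero: either the accumulated scalar γ
-- is 0, or T is built from 0̄ by scalars and ∀.  It holds for 0̄ with γ = 1,
-- is stable under ∀-introduction and substitution, and, crucially, is
-- invariant under ≃ in both directions (each axiom just regroups scalars);
-- finally every null γ.T is equivalent to 0̄.
module Submission where

open import Defs
open import Algebra.Bundles using (CommutativeRing)
open import Data.Product using (proj₂)
open import Data.List.Relation.Unary.All using (All)
open import Data.Nat using (ℕ; suc)
open import Level using (_⊔_)

module ZeroTyping {c ℓ} (S : CommutativeRing c ℓ) where
  open Lineal S
  open CommutativeRing S renaming (Carrier to Sc; _*_ to _*ˢ_; 0# to 0ˢ; 1# to 1ˢ)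

  data Null (γ : Sc) : Ty → Set (c ⊔ ℓ) where
    null-𝟘 : Null γ 𝟘
    null-· : ∀ {α T} → Null (γ *ˢ α) T → Null γ (α · T)
    null-∀ : ∀ {T} → Null γ T → Null γ (∀' T)
    null-0 : ∀ {T} → γ ≈ 0ˢ → Null γ T

  Null-resp-≈ : ∀ {γ γ′ T} → γ ≈ γ′ → Null γ T → Null γ′ T
  Null-resp-≈ γ≈γ′ null-𝟘     = null-𝟘
  Null-resp-≈ γ≈γ′ (null-· n) = null-· (Null-resp-≈ (*-cong γ≈γ′ refl) n)
  Null-resp-≈ γ≈γ′ (null-∀ n) = null-∀ (Null-resp-≈ γ≈γ′ n)
  Null-resp-≈ γ≈γ′ (null-0 γ≈0) = null-0 (trans (sym γ≈γ′) γ≈0)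

  *-zero-absorbˡ : ∀ {γ} α → γ ≈ 0ˢ → γ *ˢ α ≈ 0ˢ
  *-zero-absorbˡ α γ≈0 = trans (*-cong γ≈0 refl) (zeroˡ α)

  mutual
    Null-resp-≃ : ∀ {T R γ} → T ≃ R → Null γ T → Null γ R
    Null-resp-≃ (≃-refl _)    n = n
    Null-resp-≃ (≃-sym e)     n = Null-resp-≃˘ e n
    Null-resp-≃ (≃-trans e f) n = Null-resp-≃ f (Null-resp-≃ e n)
    Null-resp-≃ (ax-α0 α)     _ = null-𝟘
    Null-resp-≃ (ax-0T _)     _ = null-𝟘
    Null-resp-≃ (ax-1T _) (null-· n)   = Null-resp-≈ (*-identityʳ _) n
    Null-resp-≃ (ax-1T _) (null-0 γ≈0) = null-0 γ≈0
    Null-resp-≃ (ax-αβ α β _) (null-· (null-· n)) =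
      null-· (Null-resp-≈ (*-assoc _ α β) n)
    Null-resp-≃ (ax-αβ α β _) (null-· (null-0 γα≈0)) =
      null-· (null-0 (trans (sym (*-assoc _ α β)) (*-zero-absorbˡ β γα≈0)))
    Null-resp-≃ (ax-αβ α β _) (null-0 γ≈0) = null-0 γ≈0
    Null-resp-≃ (ax-∀α α _) (null-∀ (null-· n))   = null-· (null-∀ n)
    Null-resp-≃ (ax-∀α α _) (null-∀ (null-0 γ≈0)) = null-· (null-0 (*-zero-absorbˡ α γ≈0))
    Null-resp-≃ (ax-∀α α _) (null-0 γ≈0)          = null-0 γ≈0
    Null-resp-≃ (c-scal α≈β e) (null-· n)   =
      null-· (Null-resp-≃ e (Null-resp-≈ (*-cong refl α≈β) n))
    Null-resp-≃ (c-scal α≈β e) (null-0 γ≈0) = null-0 γ≈0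
    Null-resp-≃ (c-all e) (null-∀ n)   = null-∀ (Null-resp-≃ e n)
    Null-resp-≃ (c-all e) (null-0 γ≈0) = null-0 γ≈0
    Null-resp-≃ (c-arr _ _ _ _) (null-0 γ≈0) = null-0 γ≈0

    Null-resp-≃˘ : ∀ {T R γ} → T ≃ R → Null γ R → Null γ T
    Null-resp-≃˘ (≃-refl _)    n = n
    Null-resp-≃˘ (≃-sym e)     n = Null-resp-≃ e n
    Null-resp-≃˘ (≃-trans e f) n = Null-resp-≃˘ e (Null-resp-≃˘ f n)
    Null-resp-≃˘ (ax-α0 α) null-𝟘       = null-· null-𝟘
    Null-resp-≃˘ (ax-α0 α) (null-0 γ≈0) = null-0 γ≈0
    Null-resp-≃˘ (ax-0T _) null-𝟘       = null-· (null-0 (zeroʳ _))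
    Null-resp-≃˘ (ax-0T _) (null-0 γ≈0) = null-0 γ≈0
    Null-resp-≃˘ (ax-1T _) n = null-· (Null-resp-≈ (sym (*-identityʳ _)) n)
    Null-resp-≃˘ (ax-αβ α β _) (null-· n)   =
      null-· (null-· (Null-resp-≈ (sym (*-assoc _ α β)) n))
    Null-resp-≃˘ (ax-αβ α β _) (null-0 γ≈0) = null-0 γ≈0
    Null-resp-≃˘ (ax-∀α α _) (null-· (null-∀ n))   = null-∀ (null-· n)
    Null-resp-≃˘ (ax-∀α α _) (null-· (null-0 γα≈0)) = null-∀ (null-· (null-0 γα≈0))
    Null-resp-≃˘ (ax-∀α α _) (null-0 γ≈0)          = null-0 γ≈0
    Null-resp-≃˘ (c-scal α≈β e) (null-· n)   =
      null-· (Null-resp-≃˘ e (Null-resp-≈ (*-cong refl (sym α≈β)) n))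
    Null-resp-≃˘ (c-scal α≈β e) (null-0 γ≈0) = null-0 γ≈0
    Null-resp-≃˘ (c-all e) (null-∀ n)   = null-∀ (Null-resp-≃˘ e n)
    Null-resp-≃˘ (c-all e) (null-0 γ≈0) = null-0 γ≈0
    Null-resp-≃˘ (c-arr _ _ _ _) (null-0 γ≈0) = null-0 γ≈0

  Null-subst : ∀ {γ T} k U → Null γ T → Null γ (subst k U T)
  Null-subst k U null-𝟘       = null-𝟘
  Null-subst k U (null-· n)   = null-· (Null-subst k U n)
  Null-subst k U (null-∀ n)   = null-∀ (Null-subst (suc k) U n)
  Null-subst k U (null-0 γ≈0) = null-0 γ≈0

  Null-instantiate : ∀ {γ T} U → Null γ (∀' T) → Null γ (T [ U ])
  Null-instantiate U (null-∀ n)   = Null-subst 0 U n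
  Null-instantiate U (null-0 γ≈0) = null-0 γ≈0

  ⊢𝟎⇒Null : ∀ {Γ T} → Γ ⊢ 𝟎 ∷ T → Null 1ˢ T
  ⊢𝟎⇒Null (≡-r d e)          = Null-resp-≃ e (⊢𝟎⇒Null d)
  ⊢𝟎⇒Null (∀E {U = U} _ d)   = Null-instantiate U (⊢𝟎⇒Null d)
  ⊢𝟎⇒Null (∀I d)             = null-∀ (⊢𝟎⇒Null d)
  ⊢𝟎⇒Null ax0                = null-𝟘

  IsType-·⁻ : ∀ {α T} → IsType (α · T) → IsType T
  IsType-·⁻ (t-unit ())
  IsType-·⁻ (t-scal _ t) = t

  IsType-∀⁻ : ∀ {T} → IsType (∀' T) → IsType T
  IsType-∀⁻ (t-unit (u-all u)) = t-unit u
  IsType-∀⁻ (t-all t)          = t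

  ∀𝟘≃𝟘 : ∀' 𝟘 ≃ 𝟘
  ∀𝟘≃𝟘 = ≃-trans (c-all (≃-sym (ax-α0 0ˢ)))
           (≃-trans (ax-∀α 0ˢ t-zero) (ax-0T (t-all t-zero)))

  Null⇒·≃𝟘 : ∀ {γ T} → Null γ T → IsType T → γ · T ≃ 𝟘
  Null⇒·≃𝟘 null-𝟘         _ = ax-α0 _
  Null⇒·≃𝟘 (null-· {α} n) t =
    ≃-trans (ax-αβ _ α (IsType-·⁻ t)) (Null⇒·≃𝟘 n (IsType-·⁻ t))
  Null⇒·≃𝟘 (null-∀ n)     t =
    ≃-trans (≃-sym (ax-∀α _ (IsType-∀⁻ t)))
      (≃-trans (c-all (Null⇒·≃𝟘 n (IsType-∀⁻ t))) ∀𝟘≃𝟘)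
  Null⇒·≃𝟘 (null-0 γ≈0)   t = ≃-trans (c-scal γ≈0 (≃-refl t)) (ax-0T t)

mainTheorem15 : ∀ {c ℓ} (S : CommutativeRing c ℓ) → let open Lineal S in
    (Γ : Ctx) → All (λ b → IsUnit (proj₂ b)) Γ →
    (T : Ty) → IsType T →
    Γ ⊢ 𝟎 ∷ T → T ≃ 𝟘
mainTheorem15 S Γ _ T t d =
  ≃-trans (≃-sym (ax-1T t)) (Null⇒·≃𝟘 (⊢𝟎⇒Null d) t)
  where
    open Lineal S
    open ZeroTyping S
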